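{- Let $\Pi = (\mathcal{A}, \mathcal{E}, \mathcal{R})$ be an ELP, $\Phi \subseteq \mathcal{E}$ a guess for $\Pi$, and suppose $\mathcal{Y} = \mathcal{SE}_\Pi(\Phi)$ is non-empty. Then there is a set $\mathcal{C} \subseteq \{ Y \mid (X, Y) \in \mathcal{Y} \}$ of polynomial size in $\Pi$ that is $\Phi$-compatible w.r.t. $\mathcal{E}$.
   Context: Literals over a set of atoms $\mathcal{A}$ are atoms or their default negations $\neg a$. An interpretation is $I\subseteq\mathcal{A}$; $I\models a$ iff $a\in I$, $I\models\neg\varphi$ iff $I\not\models\varphi$. A logic program is a pair $(\mathcal{A},\mathcal{R})$ with rules $a_1\vee\cdots\vee a_l\leftarrow a_{l+1},\ldots,a_m,\neg\ell_1,\ldots,\neg\ell_n$ ($\ell_i$ literals); $I$ is a model of a rule if, whenever $I$ satisfies all body elements, $I$ contains some head atom; $\mathrm{Mods}(\Pi)$ is the set of models. The GL-reduct $\Pi^I$ consists of $\mathrm{head}(r)\leftarrow\mathrm{pbody}(r)$ for the rules $r$ with $I\models\neg\ell$ for all $\neg\ell$ in the body. An SE-model of a logic program $\Pi$ is $(X,Y)$ with $X\subseteq Y\subseteq\mathcal{A}$, $Y\models\Pi$, $X\models\Pi^Y$; $\mathrm{SE}(\Pi)$ is the set of SE-models. An ELP is $(\mathcal{A},\mathcal{E},\mathcal{R})$, $\mathcal{E}$ a set of epistemic literals $\mathbf{not}\,\ell$ over $\mathcal{A}$, rules $a_1\vee\cdots\vee a_k\leftarrow\ell_1,\ldots,\ell_m,\xi_1,\ldots,\xi_j,\neg\xi_{j+1},\ldots,\neg\xi_n$,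 $\xi_i\in\mathcal{E}$. A guess is $\Phi\subseteq\mathcal{E}$. $\mathcal{I}$ is $\Phi$-compatible w.r.t. $\mathcal{E}$ iff $\mathcal{I}\neq\emptyset$, each $\mathbf{not}\,\ell\in\Phi$ has some $I\in\mathcal{I}$ with $I\not\models\ell$, and each $\mathbf{not}\,\ell\in\mathcal{E}\setminus\Phi$ has $I\models\ell$ for all $I\in\mathcal{I}$. The epistemic reduct $\Pi^\Phi$ replaces each $\mathbf{not}\,\ell\in\Phi$ by $\top$ and every remaining $\mathbf{not}$ by $\neg$ ($\neg\neg\neg a$ treated as $\neg a$). $\Phi$ is realizable in $\Pi$ iff some subset of $\mathrm{Mods}(\Pi^\Phi)$ is $\Phi$-compatible w.r.t. $\mathcal{E}$. The SE-function is $\mathcal{SE}_\Pi(\Phi)=\mathrm{SE}(\Pi^\Phi)$ if $\Phi$ is realizable in $\Pi$, and $\emptyset$ otherwise. -}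

module Defs where

open import Data.Nat using (ℕ; _+_; _*_; _^_; _≤_)
open import Data.Fin using (Fin)
import Data.Fin.Properties as FinP
open import Data.Fin.Subset using (Subset; _∈_; _∉_; _⊆_)
open import Data.Fin.Subset.Properties using (_∈?_)
open import Data.List using (List; []; _∷_; length; filter; map; _++_)
open import Data.Nat.ListAction using (sum)
open import Data.List.Relation.Unary.All as All using (All)
open import Data.List.Relation.Unary.Any as Any using (Any)
import Data.List.Membership.Propositional as LMem
open import Data.Maybe using (Maybe; just; nothing)
open import Data.Product using (_×_; Σ; ∃; ∃-syntax; _,_)
open import Relation.Nullary using (¬_; Dec; yes; no)
open import Relation.Nullary.Decidable using (¬?)
open import Relation.Binary.PropositionalEquality using (_≡_; refl; cong)
open import Data.Empty using (⊥)

-- Atoms are Fin n (the set 𝒜 has n elements); interpretations are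
-- subsets of the atoms.

Interp : ℕ → Set
Interp n = Subset n

data Lit (n : ℕ) : Set where
  pos : Fin n → Lit n
  neg : Fin n → Lit n

_≟L_ : ∀ {n} (l m : Lit n) → Dec (l ≡ m)
pos a ≟L pos b with a FinP.≟ b
... | yes refl = yes refl
... | no a≢b = no λ { refl → a≢b refl }
pos a ≟L neg b = no λ ()
neg a ≟L pos b = no λ ()
neg a ≟L neg b with a FinP.≟ b
... | yes refl = yes refl
... | no a≢b = no λ { refl → a≢b refl }

_⊨L_ : ∀ {n} → Interp n → Lit n → Set
I ⊨L pos a = a ∈ I
I ⊨L neg a = a ∉ I

_⊨L?_ : ∀ {n} (I : Interp n) (l : Lit n) → Dec (I ⊨L l)
I ⊨L? pos a = a ∈? I
I ⊨L? neg a = ¬? (a ∈? I)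

-- Logic programs.
-- A rule  a₁ ∨ … ∨ a_l ← a_{l+1},…,a_m, ¬ℓ₁,…,¬ℓ_n
-- is stored as head = [a₁…a_l], pbody = [a_{l+1}…a_m],
-- nbody = [ℓ₁ … ℓ_n]  (each entry ℓ stands for the body element ¬ℓ).

record Rule (n : ℕ) : Set where
  constructor rule
  field
    head  : List (Fin n)
    pbody : List (Fin n)
    nbody : List (Lit n)
open Rule public

LP : ℕ → Set
LP n = List (Rule n)

NegBodySat : ∀ {n} → Interp n → Rule n → Set
NegBodySat I r = All (λ l → ¬ (I ⊨L l)) (nbody r)

NegBodySat? : ∀ {n} (I : Interp n) (r : Rule n) → Dec (NegBodySat I r)
NegBodySat? I r = All.all? (λ l → ¬? (I ⊨L? l)) (nbody r)

_⊨R_ : ∀ {n} → Interp n → Rule n → Set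
I ⊨R r = All (λ a → a ∈ I) (pbody r) → NegBodySat I r → Any (λ a → a ∈ I) (head r)

_⊨P_ : ∀ {n} → Interp n → LP n → Set
I ⊨P Π = All (λ r → I ⊨R r) Π

Mods : ∀ {n} → LP n → Interp n → Set
Mods Π I = I ⊨P Π

GL : ∀ {n} → LP n → Interp n → LP n
GL Π I = map (λ r → rule (head r) (pbody r) []) (filter (NegBodySat? I) Π)

SE : ∀ {n} → LP n → Interp n → Interp n → Set
SE Π X Y = X ⊆ Y × Y ⊨P Π × X ⊨P GL Π Y

-- An epistemic literal  not ℓ  is represented by its literal ℓ.
-- A rule  a₁ ∨ … ∨ a_k ← ℓ₁,…,ℓ_m, ξ₁,…,ξ_j, ¬ξ_{j+1},…,¬ξ_n
-- is stored as head, body = [ℓ₁…ℓ_m], epos = [ξ₁…ξ_j], eneg = [ξ_{j+1}…ξ_n].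

record ERule (n : ℕ) : Set where
  constructor erule
  field
    ehead : List (Fin n)
    ebody : List (Lit n)
    epos  : List (Lit n)
    eneg  : List (Lit n)
open ERule public

record ELP (n : ℕ) : Set where
  constructor elp
  field
    E : List (Lit n)
    R : List (ERule n)
open ELP public

WellFormed : ∀ {n} → ELP n → Set
WellFormed Π = All (λ r → All (λ ξ → ξ LMem.∈ E Π) (epos r) × All (λ ξ → ξ LMem.∈ E Π) (eneg r)) (R Π)

Guess : ∀ {n} → ELP n → List (Lit n) → Set
Guess Π Φ = All (λ ξ → ξ LMem.∈ E Π) Φ

_∈Φ?_ : ∀ {n} (ξ : Lit n) (Φ : List (Lit n)) → Dec (ξ LMem.∈ Φ)
ξ ∈Φ? Φ = Any.any? (ξ ≟L_) Φ

bodyPos : ∀ {n} → List (Lit n) → List (Fin n)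
bodyPos [] = []
bodyPos (pos a ∷ ls) = a ∷ bodyPos ls
bodyPos (neg a ∷ ls) = bodyPos ls

bodyNeg : ∀ {n} → List (Lit n) → List (Lit n)
bodyNeg [] = []
bodyNeg (pos a ∷ ls) = bodyNeg ls
bodyNeg (neg a ∷ ls) = pos a ∷ bodyNeg ls     -- ¬a

-- positive occurrences  not ℓ  with not ℓ ∉ Φ become ¬ℓ;
-- those with not ℓ ∈ Φ become ⊤ (dropped).
eposNeg : ∀ {n} → List (Lit n) → List (Lit n) → List (Lit n)
eposNeg Φ [] = []
eposNeg Φ (ξ ∷ ξs) with ξ ∈Φ? Φ
... | yes _ = eposNeg Φ ξs
... | no _  = ξ ∷ eposNeg Φ ξs

-- negated occurrences ¬ not ℓ with not ℓ ∉ Φ become ¬¬ℓ,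
-- where ¬¬¬a is treated as ¬a.
flipLit : ∀ {n} → Lit n → Lit n
flipLit (pos a) = neg a   -- ¬¬a   (stored as ¬(¬a))
flipLit (neg a) = pos a   -- ¬¬¬a = ¬a

-- Epistemic reduct of a single rule.  If some ¬ξ with ξ ∈ Φ occurs, the
-- body contains ¬⊤ and the rule is dropped (it is vacuously satisfied and
-- never survives a GL-reduct).
reduceRule : ∀ {n} → List (Lit n) → ERule n → Maybe (Rule n)
reduceRule Φ r with Any.any? (λ ξ → ξ ∈Φ? Φ) (eneg r)
... | yes _ = nothing
... | no _  = just (rule (ehead r) (bodyPos (ebody r))
                     (bodyNeg (ebody r) ++ eposNeg Φ (epos r) ++ map flipLit (eneg r)))

EReduct : ∀ {n} → ELP n → List (Lit n) → LP n
EReduct Π Φ = Data.List.mapMaybe (reduceRule Φ) (R Π)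

Compatible : ∀ {n} → List (Lit n) → List (Lit n) → List (Interp n) → Set
Compatible E Φ 𝓘 =
  ¬ (𝓘 ≡ [])
  × All (λ l → Any (λ I → ¬ (I ⊨L l)) 𝓘) Φ
  × All (λ l → ¬ (l LMem.∈ Φ) → All (λ I → I ⊨L l) 𝓘) E

Realizable : ∀ {n} → ELP n → List (Lit n) → Set
Realizable Π Φ = ∃[ 𝓘 ] (All (Mods (EReduct Π Φ)) 𝓘 × Compatible (E Π) Φ 𝓘)

SEfun : ∀ {n} → ELP n → List (Lit n) → Interp n → Interp n → Set
SEfun Π Φ X Y = Realizable Π Φ × SE (EReduct Π Φ) X Y

ruleSize : ∀ {n} → ERule n → ℕ
ruleSize r = 1 + length (ehead r) + length (ebody r) + length (epos r) + length (eneg r)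

size : ∀ {n} → ELP n → ℕ
size {n} Π = n + length (E Π) + sum (map ruleSize (R Π))

module Submission where

-- Non-emptiness of 𝒮ℰ_Π(Φ) means Φ is realizable: there is a
-- Φ-compatible list 𝓘 of models of the reduct Π^Φ.  Two general facts finish
-- the argument.
--   * Every model Y of a logic program P gives the SE-model (Y , Y) of P,
--     because Y is a model of its own GL-reduct P^Y.  Hence every member of
--     𝓘 is the second component of some SE-model in 𝒮ℰ_Π(Φ).
--   * A Φ-compatible list can be shrunk to at most 1 + |ℰ| members: keep one
--     fixed member (non-emptiness) and, for each  not ℓ ∈ ℰ  lying in Φ, one
--     member falsifying ℓ.  The universal condition for ℰ ∖ Φ is inherited by
--     every sublist.
-- Since |ℰ| ≤ size Π, the shrunken list has length ≤ size Π + 1, which is the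
-- polynomial bound c · size Π ^ k + c with c = k = 1.

open import Defs
open import Data.Nat using (ℕ; suc; _+_; _*_; _^_; _≤_)
open import Data.Nat.Properties
  using (module ≤-Reasoning; ≤-trans; ≤-reflexive; m≤m+n; m≤n+m; +-monoˡ-≤; +-comm; *-identityˡ; ^-identityʳ)
open import Data.List using (List; []; _∷_; length; map)
open import Data.List.Properties using (length-map)
open import Data.List.Relation.Unary.All as All using (All; []; _∷_)
open import Data.List.Relation.Unary.All.Properties using (map⁺)
open import Data.List.Relation.Unary.Any using (Any; here; there)
open import Data.List.Membership.Propositional using (_∈_; find; lose)
open import Data.List.Membership.Propositional.Properties using (∈-map⁺)
open import Data.Product using (_×_; Σ; ∃; ∃-syntax; _,_; proj₁; proj₂)
open import Data.Empty using (⊥-elim)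
open import Data.Fin.Subset.Properties using (⊆-refl)
open import Relation.Nullary using (¬_; yes; no)
open import Relation.Binary.PropositionalEquality using (refl; sym; trans; cong)

-- A model of a logic program is a model of its own GL-reduct: each reduct
-- rule comes from a rule whose negative body I satisfies.
model⇒model-of-GL : ∀ {n} (P : LP n) (I : Interp n) → I ⊨P P → I ⊨P GL P I
model⇒model-of-GL []      I []         = []
model⇒model-of-GL (r ∷ P) I (I⊨r ∷ I⊨P) with NegBodySat? I r
... | yes I⊨nbody = (λ I⊨pbody _ → I⊨r I⊨pbody I⊨nbody) ∷ model⇒model-of-GL P I I⊨P
... | no  _       = model⇒model-of-GL P I I⊨P

model⇒SE-diagonal : ∀ {n} (P : LP n) (Y : Interp n) → Y ⊨P P → SE P Y Y
model⇒SE-diagonal P Y Y⊨P = ⊆-refl , Y⊨P , model⇒model-of-GL P Y Y⊨P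

universal-part-sublist : ∀ {n} (E Φ : List (Lit n)) {𝓘 𝓒 : List (Interp n)} →
  All (_∈ 𝓘) 𝓒 →
  All (λ l → ¬ (l ∈ Φ) → All (λ I → I ⊨L l) 𝓘) E →
  All (λ l → ¬ (l ∈ Φ) → All (λ I → I ⊨L l) 𝓒) E
universal-part-sublist E Φ 𝓒⊆𝓘 univ =
  All.map (λ true-in-𝓘 l∉Φ → All.map (All.lookup (true-in-𝓘 l∉Φ)) 𝓒⊆𝓘) univ

representative : ∀ {n} (Φ : List (Lit n)) {𝓘 : List (Interp n)} {I₀ : Interp n} →
  I₀ ∈ 𝓘 → All (λ l → Any (λ I → ¬ (I ⊨L l)) 𝓘) Φ →
  (l : Lit n) → Σ (Interp n) λ I → I ∈ 𝓘 × (l ∈ Φ → ¬ (I ⊨L l))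
representative Φ I₀∈𝓘 falsifiers l with l ∈Φ? Φ
... | yes l∈Φ = let (I , I∈𝓘 , I⊭l) = find (All.lookup falsifiers l∈Φ)
                in I , I∈𝓘 , λ _ → I⊭l
... | no  l∉Φ = _ , I₀∈𝓘 , λ l∈Φ → ⊥-elim (l∉Φ l∈Φ)

-- Shrinking: a Φ-compatible list has a Φ-compatible sublist with at most
-- 1 + |ℰ| members (one default member and one representative per ℓ ∈ ℰ).
compatible-shrink : ∀ {n} (E Φ : List (Lit n)) (𝓘 : List (Interp n)) →
  All (_∈ E) Φ → Compatible E Φ 𝓘 →
  ∃[ 𝓒 ] (All (_∈ 𝓘) 𝓒 × Compatible E Φ 𝓒 × length 𝓒 ≤ suc (length E))
compatible-shrink E Φ [] Φ⊆E (𝓘≢[] , _) = ⊥-elim (𝓘≢[] refl)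
compatible-shrink {n} E Φ 𝓘@(I₀ ∷ _) Φ⊆E (_ , falsifiers , univ) =
  𝓒 , 𝓒⊆𝓘 , ((λ ()) , falsified , universal-part-sublist E Φ 𝓒⊆𝓘 univ) ,
  ≤-reflexive (cong suc (length-map rep E))
  where
  rep : Lit n → Interp n
  rep l = proj₁ (representative Φ (here refl) falsifiers l)

  𝓒 : List (Interp n)
  𝓒 = I₀ ∷ map rep E

  𝓒⊆𝓘 : All (_∈ 𝓘) 𝓒
  𝓒⊆𝓘 = here refl ∷ map⁺ (All.universal
          (λ l → proj₁ (proj₂ (representative Φ (here refl) falsifiers l))) E)

  falsified : All (λ l → Any (λ I → ¬ (I ⊨L l)) 𝓒) Φ
  falsified = All.tabulate λ {l} l∈Φ →
    there (lose (∈-map⁺ rep (All.lookup Φ⊆E l∈Φ))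
                (proj₂ (proj₂ (representative Φ (here refl) falsifiers l)) l∈Φ))

epistemic-count≤size : ∀ {n} (Π : ELP n) → suc (length (E Π)) ≤ 1 * size Π ^ 1 + 1
epistemic-count≤size {n} Π = begin
  suc (length (E Π))        ≡⟨ +-comm 1 (length (E Π)) ⟩
  length (E Π) + 1          ≤⟨ +-monoˡ-≤ 1 |E|≤size ⟩
  size Π + 1                ≡⟨ cong (_+ 1) (sym (trans (*-identityˡ _) (^-identityʳ _))) ⟩
  1 * size Π ^ 1 + 1        ∎
  where
  open ≤-Reasoning
  |E|≤size : length (E Π) ≤ size Π
  |E|≤size = ≤-trans (m≤n+m (length (E Π)) n) (m≤m+n _ _)

lemma3 : Σ ℕ λ c → Σ ℕ λ k →
           ∀ {n} (Π : ELP n) (Φ : List (Lit n)) → WellFormed Π → Guess Π Φ →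
           (∃[ X ] ∃[ Y ] SEfun Π Φ X Y) →
           ∃[ 𝓒 ] (All (λ Y → ∃[ X ] SEfun Π Φ X Y) 𝓒
                   × Compatible (E Π) Φ 𝓒
                   × length 𝓒 ≤ c * size Π ^ k + c)
lemma3 = 1 , 1 , λ Π Φ _ Φ⊆E (_ , _ , realizable , _) →
  let (𝓘 , 𝓘⊨Π^Φ , 𝓘-compatible) = realizable
      (𝓒 , 𝓒⊆𝓘 , 𝓒-compatible , |𝓒|≤) = compatible-shrink (E Π) Φ 𝓘 Φ⊆E 𝓘-compatible
      SE-witness = λ {Y} Y∈𝓘 →
        Y , realizable , model⇒SE-diagonal (EReduct Π Φ) Y (All.lookup 𝓘⊨Π^Φ Y∈𝓘)
  in 𝓒 , All.map SE-witness 𝓒⊆𝓘 , 𝓒-compatible , ≤-trans |𝓒|≤ (epistemic-count≤size Π)
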